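{- Let $\mathbf C$ be a guarded pre-iterative category, let $\sigma\colon Z\triangleleft Y$ be a summand, and let $f\colon X\to_{\sigma+\mathrm{id}}Y+X$. Then $f^\dagger\colon X\to_\sigma Y$.
   Context: $\mathbf C$ has finite coproducts. A summand $\sigma\colon Z\triangleleft Y$ is a pair $(\sigma_1\colon Z\to Y,\sigma_2)$ forming a coproduct cospan; $\sigma+\mathrm{id}$ is the summand $Z+X\triangleleft Y+X$ with first injection $\sigma_1+\mathrm{id}_X$. $\mathbf C$ is abstractly guarded if equipped with a relation $f\colon X\to_\sigma Y$ closed under (trv) $\mathrm{inl}\circ f\colon X\to_{\mathrm{inr}}Y+Z$ for all $f$; (par) $f\colon X\to_\sigma Z$, $g\colon Y\to_\sigma Z$ imply $[f,g]\colon X+Y\to_\sigma Z$; (cmp) $f\colon X\to_{\mathrm{inr}}Y+Z$, $g\colon Y\to_\sigma V$, $h\colon Z\to V$ imply $[g,h]\circ f\colon X\to_\sigma V$ (over all coproducts). It is guarded pre-iterative if equipped with an operator assigning to every $f\colon X\to_{\mathrm{inr}}Y+X$ a morphism $f^\dagger\colon X\to Y$ with $f^\dagger=[\mathrm{id},f^\dagger]\circ f$. (The hypothesis $f\colon X\to_{\sigma+\mathrm{id}}Y+X$ implies $f$ is $\mathrm{inr}$-guarded, so $f^\dagger$ is defined.) -}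

module Defs where

open import Level using (Level; _⊔_; suc)
open import Relation.Binary.PropositionalEquality using (_≡_)

record Category (o ℓ : Level) : Set (suc (o ⊔ ℓ)) where
  infixr 9 _∘_
  field
    Obj  : Set o
    Hom  : Obj → Obj → Set ℓ
    id   : ∀ {A} → Hom A A
    _∘_  : ∀ {A B C} → Hom B C → Hom A B → Hom A C
    identityˡ : ∀ {A B} {f : Hom A B} → id ∘ f ≡ f
    identityʳ : ∀ {A B} {f : Hom A B} → f ∘ id ≡ f
    assoc : ∀ {A B C D} {f : Hom A B} {g : Hom B C} {h : Hom C D} →
            (h ∘ g) ∘ f ≡ h ∘ (g ∘ f)

module _ {o ℓ} (C : Category o ℓ) where
  open Category C

  record IsCoproduct {A B S : Obj} (i₁ : Hom A S) (i₂ : Hom B S) : Set (o ⊔ ℓ) where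
    field
      copair : ∀ {V} → Hom A V → Hom B V → Hom S V
      copair-β₁ : ∀ {V} {f : Hom A V} {g : Hom B V} → copair f g ∘ i₁ ≡ f
      copair-β₂ : ∀ {V} {f : Hom A V} {g : Hom B V} → copair f g ∘ i₂ ≡ g
      copair-unique : ∀ {V} {f : Hom A V} {g : Hom B V} (h : Hom S V) →
                      h ∘ i₁ ≡ f → h ∘ i₂ ≡ g → h ≡ copair f g

  record IsInitial (I : Obj) : Set (o ⊔ ℓ) where
    field
      ! : ∀ {V} → Hom I V
      !-unique : ∀ {V} (h : Hom I V) → h ≡ !

record CoproductCategory (o ℓ : Level) : Set (suc (o ⊔ ℓ)) where
  field
    cat : Category o ℓ
  open Category cat
  infixr 6 _+_
  field
    ⊥Obj     : Obj
    ⊥-initial : IsInitial cat ⊥Obj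
    _+_ : Obj → Obj → Obj
    inl : ∀ {A B} → Hom A (A + B)
    inr : ∀ {A B} → Hom B (A + B)
    +-coproduct : ∀ {A B} → IsCoproduct cat (inl {A} {B}) (inr {A} {B})

  [_,_] : ∀ {A B V} → Hom A V → Hom B V → Hom (A + B) V
  [ f , g ] = IsCoproduct.copair +-coproduct f g

  _⊕_ : ∀ {A B A' B'} → Hom A A' → Hom B B' → Hom (A + B) (A' + B')
  f ⊕ g = [ inl ∘ f , inr ∘ g ]

  record Summand (Z Y : Obj) : Set (o ⊔ ℓ) where
    field
      {Compl} : Obj
      σ₁ : Hom Z Y
      σ₂ : Hom Compl Y
      isCoproduct : IsCoproduct cat σ₁ σ₂

-- An abstractly guarded category.  Guarded f σ₁ σ₂ means f : X →_σ Y for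
-- the summand σ = (σ₁, σ₂) (σ₁ the guarded injection, σ₂ its complement).
record AbstractlyGuarded (o ℓ g : Level) : Set (suc (o ⊔ ℓ ⊔ g)) where
  field
    coprod : CoproductCategory o ℓ
  open CoproductCategory coprod public
  open Category cat public
  field
    Guarded : ∀ {X Y Z W} → Hom X Y → Hom Z Y → Hom W Y → Set g
    trv : ∀ {X A B S} {i₁ : Hom A S} {i₂ : Hom B S} →
          IsCoproduct cat i₁ i₂ → (f : Hom X A) → Guarded (i₁ ∘ f) i₂ i₁
    par : ∀ {X Y T Z Z₁ Z₂} {j₁ : Hom X T} {j₂ : Hom Y T}
            {σ₁ : Hom Z₁ Z} {σ₂ : Hom Z₂ Z} →
          (cp : IsCoproduct cat j₁ j₂) → IsCoproduct cat σ₁ σ₂ →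
          {f : Hom X Z} {g : Hom Y Z} →
          Guarded f σ₁ σ₂ → Guarded g σ₁ σ₂ →
          Guarded (IsCoproduct.copair cp f g) σ₁ σ₂
    cmp : ∀ {X Y Z S V V₁ V₂} {i₁ : Hom Y S} {i₂ : Hom Z S}
            {σ₁ : Hom V₁ V} {σ₂ : Hom V₂ V} →
          (cp : IsCoproduct cat i₁ i₂) → IsCoproduct cat σ₁ σ₂ →
          {f : Hom X S} {g : Hom Y V} {h : Hom Z V} →
          Guarded f i₂ i₁ → Guarded g σ₁ σ₂ →
          Guarded (IsCoproduct.copair cp g h ∘ f) σ₁ σ₂

  _⇒[_] : ∀ {X Y Z} → Hom X Y → Summand Z Y → Set g
  f ⇒[ σ ] = Guarded f (Summand.σ₁ σ) (Summand.σ₂ σ)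

-- A guarded pre-iterative category.  The guardedness proof is an
-- irrelevant argument, so f† does not depend on it.
record GuardedPreIterative (o ℓ g : Level) : Set (suc (o ⊔ ℓ ⊔ g)) where
  field
    guarded : AbstractlyGuarded o ℓ g
  open AbstractlyGuarded guarded public
  field
    _† : ∀ {X Y} (f : Hom X (Y + X)) → .(Guarded f inr inl) → Hom X Y
    fixpoint : ∀ {X Y} (f : Hom X (Y + X)) .(p : Guarded f inr inl) →
               (f †) p ≡ [ id , (f †) p ] ∘ f

  -- σ + id : Z + X ◁ Y + X, first injection σ₁ + id, complement inl ∘ σ₂
  -- (the guardedness relation only looks at the two injections).
  _⇒[_+id] : ∀ {X Y Z A} → Hom A (Y + X) → Summand Z Y → Set g
  _⇒[_+id] {X} f σ = Guarded f (Summand.σ₁ σ ⊕ id {X}) (inl ∘ Summand.σ₂ σ)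

-- Decompose Y + X as Compl + (Z + X) along σ + id.  Then (cmp), applied to
-- the (σ + id)-guarded f, the σ-guarded complement injection σ₂ (trv) and the
-- unguarded [id , h] ∘ (σ₁ + id), shows that [id , h] ∘ f is σ-guarded for
-- every h : X → Y.  Taking h = f† and using the fixpoint equation
-- f† = [id , f†] ∘ f gives the claim.
module Submission where

open import Level using (Level)
open import Relation.Binary.PropositionalEquality
open import Defs

module _ {o ℓ} (C : Category o ℓ) where
  open Category C

  IsCoproduct-sym : ∀ {A B S} {i₁ : Hom A S} {i₂ : Hom B S} →
                    IsCoproduct C i₁ i₂ → IsCoproduct C i₂ i₁
  IsCoproduct-sym cp = record
    { copair        = λ f g → copair g f
    ; copair-β₁     = copair-β₂
    ; copair-β₂     = copair-β₁
    ; copair-unique = λ h e₁ e₂ → copair-unique h e₂ e₁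
    }
    where open IsCoproduct cp

module CoproductProperties {o ℓ} (CC : CoproductCategory o ℓ) where
  open CoproductCategory CC
  open Category cat
  open ≡-Reasoning

  []-β₁ : ∀ {A B V} {f : Hom A V} {g : Hom B V} → [ f , g ] ∘ inl ≡ f
  []-β₁ = IsCoproduct.copair-β₁ +-coproduct

  []-β₂ : ∀ {A B V} {f : Hom A V} {g : Hom B V} → [ f , g ] ∘ inr ≡ g
  []-β₂ = IsCoproduct.copair-β₂ +-coproduct

  +-ext : ∀ {A B V} {h k : Hom (A + B) V} →
          h ∘ inl ≡ k ∘ inl → h ∘ inr ≡ k ∘ inr → h ≡ k
  +-ext {h = h} {k} eˡ eʳ =
    trans (copair-unique h eˡ eʳ) (sym (copair-unique k refl refl))
    where open IsCoproduct +-coproduct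

  ∘-⊕-inl : ∀ {A B A' B' V} (h : Hom (A' + B') V) {f : Hom A A'} {g : Hom B B'} →
            h ∘ (f ⊕ g) ∘ inl ≡ (h ∘ inl) ∘ f
  ∘-⊕-inl h = trans (cong (h ∘_) []-β₁) (sym assoc)

  ∘-⊕-inr : ∀ {A B A' B' V} (h : Hom (A' + B') V) {f : Hom A A'} {g : Hom B B'} →
            h ∘ (f ⊕ g) ∘ inr ≡ (h ∘ inr) ∘ g
  ∘-⊕-inr h = trans (cong (h ∘_) []-β₂) (sym assoc)

  ⊕id-isCoproduct : ∀ {X Y Z W} {σ₁ : Hom Z Y} {σ₂ : Hom W Y} →
                    IsCoproduct cat σ₁ σ₂ →
                    IsCoproduct cat (inl {Y} {X} ∘ σ₂) (σ₁ ⊕ id)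
  ⊕id-isCoproduct {X} {Y} {Z} {W} {σ₁} {σ₂} σ = record
    { copair        = copair
    ; copair-β₁     = λ {_} {a} {b} → copair-β₁ a b
    ; copair-β₂     = λ {_} {a} {b} → copair-β₂ a b
    ; copair-unique = λ {_} {a} {b} → copair-unique a b
    }
    where
      module σ = IsCoproduct σ

      copair : ∀ {V} → Hom W V → Hom (Z + X) V → Hom (Y + X) V
      copair a b = [ σ.copair (b ∘ inl) a , b ∘ inr ]

      copair-β₁ : ∀ {V} (a : Hom W V) (b : Hom (Z + X) V) → copair a b ∘ inl ∘ σ₂ ≡ a
      copair-β₁ a b = begin
        copair a b ∘ inl ∘ σ₂      ≡⟨ sym assoc ⟩
        (copair a b ∘ inl) ∘ σ₂    ≡⟨ cong (_∘ σ₂) []-β₁ ⟩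
        σ.copair (b ∘ inl) a ∘ σ₂  ≡⟨ σ.copair-β₂ ⟩
        a                          ∎

      copair-β₂ : ∀ {V} (a : Hom W V) (b : Hom (Z + X) V) → copair a b ∘ (σ₁ ⊕ id) ≡ b
      copair-β₂ a b = +-ext
        (begin
          (copair a b ∘ (σ₁ ⊕ id)) ∘ inl  ≡⟨ assoc ⟩
          copair a b ∘ (σ₁ ⊕ id) ∘ inl    ≡⟨ ∘-⊕-inl (copair a b) ⟩
          (copair a b ∘ inl) ∘ σ₁         ≡⟨ cong (_∘ σ₁) []-β₁ ⟩
          σ.copair (b ∘ inl) a ∘ σ₁       ≡⟨ σ.copair-β₁ ⟩
          b ∘ inl                         ∎)
        (begin
          (copair a b ∘ (σ₁ ⊕ id)) ∘ inr  ≡⟨ assoc ⟩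
          copair a b ∘ (σ₁ ⊕ id) ∘ inr    ≡⟨ ∘-⊕-inr (copair a b) ⟩
          (copair a b ∘ inr) ∘ id         ≡⟨ identityʳ ⟩
          copair a b ∘ inr                ≡⟨ []-β₂ ⟩
          b ∘ inr                         ∎)

      copair-unique : ∀ {V} (a : Hom W V) (b : Hom (Z + X) V) (h : Hom (Y + X) V) →
                      h ∘ inl ∘ σ₂ ≡ a → h ∘ (σ₁ ⊕ id) ≡ b → h ≡ copair a b
      copair-unique a b h e₁ e₂ = +-ext
        (begin
          h ∘ inl                    ≡⟨ σ.copair-unique (h ∘ inl) onσ₁ (trans assoc e₁) ⟩
          σ.copair (b ∘ inl) a       ≡⟨ sym []-β₁ ⟩
          copair a b ∘ inl           ∎)
        (begin
          h ∘ inr                    ≡⟨ sym identityʳ ⟩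
          (h ∘ inr) ∘ id             ≡⟨ sym (∘-⊕-inr h) ⟩
          h ∘ (σ₁ ⊕ id) ∘ inr        ≡⟨ sym assoc ⟩
          (h ∘ (σ₁ ⊕ id)) ∘ inr      ≡⟨ cong (_∘ inr) e₂ ⟩
          b ∘ inr                    ≡⟨ sym []-β₂ ⟩
          copair a b ∘ inr           ∎)
        where
          onσ₁ : (h ∘ inl) ∘ σ₁ ≡ b ∘ inl
          onσ₁ = begin
            (h ∘ inl) ∘ σ₁           ≡⟨ sym (∘-⊕-inl h) ⟩
            h ∘ (σ₁ ⊕ id) ∘ inl      ≡⟨ sym assoc ⟩
            (h ∘ (σ₁ ⊕ id)) ∘ inl    ≡⟨ cong (_∘ inl) e₂ ⟩
            b ∘ inl                  ∎

module GuardedProperties {o ℓ g} (G : AbstractlyGuarded o ℓ g) where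
  open AbstractlyGuarded G
  open CoproductProperties coprod
  open ≡-Reasoning

  complement-guarded : ∀ {X Z W Y} {σ₁ : Hom Z Y} {σ₂ : Hom W Y} →
                       IsCoproduct cat σ₁ σ₂ → (h : Hom X W) → Guarded (σ₂ ∘ h) σ₁ σ₂
  complement-guarded σ = trv (IsCoproduct-sym cat σ)

  [id,-]∘-guarded : ∀ {X Y Z} (σ : Summand Z Y) {f : Hom X (Y + X)} →
                    Guarded f (Summand.σ₁ σ ⊕ id) (inl ∘ Summand.σ₂ σ) →
                    (h : Hom X Y) → ([ id , h ] ∘ f) ⇒[ σ ]
  [id,-]∘-guarded {X} {Y} σ {f} gf h =
    subst (λ k → Guarded (k ∘ f) σ₁ σ₂) split
      (cmp decomposition isCoproduct gf (complement-guarded isCoproduct id))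
    where
      open Summand σ
      decomposition : IsCoproduct cat (inl {Y} {X} ∘ σ₂) (σ₁ ⊕ id)
      decomposition = ⊕id-isCoproduct isCoproduct
      split : IsCoproduct.copair decomposition (σ₂ ∘ id) ([ id , h ] ∘ (σ₁ ⊕ id)) ≡ [ id , h ]
      split = sym (IsCoproduct.copair-unique decomposition [ id , h ]
        (begin
          [ id , h ] ∘ inl ∘ σ₂      ≡⟨ sym assoc ⟩
          ([ id , h ] ∘ inl) ∘ σ₂    ≡⟨ cong (_∘ σ₂) []-β₁ ⟩
          id ∘ σ₂                    ≡⟨ identityˡ ⟩
          σ₂                         ≡⟨ sym identityʳ ⟩
          σ₂ ∘ id                    ∎)
        refl)

proposition3p9 : ∀ {o ℓ g : Level} (C : GuardedPreIterative o ℓ g) →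
    let open GuardedPreIterative C in
    ∀ {X Y Z : Obj} (σ : Summand Z Y) (f : Hom X (Y + X)) →
    f ⇒[ σ +id] →
    .(p : Guarded f inr inl) →
    (f †) p ⇒[ σ ]
proposition3p9 C σ f gf p =
  subst (_⇒[ σ ]) (sym (fixpoint f p)) ([id,-]∘-guarded σ gf ((f †) p))
  where
    open GuardedPreIterative C
    open GuardedProperties guarded
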